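{- Let $x_1 \le x_2 \le \dots \le x_n$ be real numbers and let $w_{ij} = g(|x_i - x_j|)$ for a monotone non-increasing function $g:\mathbb{R}\to[0,1]$. Run average-linkage on these points. Then average-linkage can always merge neighbouring clusters: there is an execution of average-linkage in which, at every step, the current clusters are sets of consecutive points (intervals in the sorted order) and the two clusters merged are adjacent in this order; more precisely, whenever the current clusters are $C_1,\dots,C_m$ ordered so that every point of $C_a$ is $\le$ every point of $C_b$ for $a<b$, some pair of adjacent clusters $(C_a, C_{a+1})$ attains the maximum of $\frac{w_{C_aC_b}}{|C_a||C_b|}$ over all pairs.
   Context: For sets $A,B$ of points, $w_{AB} := \sum_{i\in A, j\in B} w_{ij}$. Average-linkage is the agglomerative procedure that starts with every point in its own cluster and repeatedly merges the two current clusters $A,B$ maximizing the average similarity $\frac{w_{AB}}{|A|\cdot|B|}$ (ties broken arbitrarily), creating a new internal tree node whose children are the trees of $A$ and $B$; it stops when one cluster remains, and outputs the resulting binary tree. -}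

module Defs where

open import Data.Nat using (ℕ; zero; suc)
open import Data.Bool using (true; false)
open import Data.Fin using (Fin; zero; suc)
open import Data.Fin.Subset using (Subset; ∣_∣)
open import Data.Vec using ([]; _∷_)
open import Data.Sum using (inj₁; inj₂)
open import Relation.Binary.PropositionalEquality using (_≡_; _≢_)
open import Relation.Binary.Structures using (IsTotalOrder)
open import Algebra.Structures using (IsCommutativeRing)

-- An ordered field (the real numbers ℝ are the intended instance).
record OrderedField : Set₁ where
  infixl 6 _+_ _-_
  infixl 7 _*_
  infix 4 _≤_
  field
    Carrier : Set
    0# 1# : Carrier
    _+_ _*_ : Carrier → Carrier → Carrier
    -_ : Carrier → Carrier
    _⁻¹ : Carrier → Carrier
    _≤_ : Carrier → Carrier → Set
    isCommutativeRing : IsCommutativeRing _≡_ _+_ _*_ -_ 0# 1#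
    0≢1 : 0# ≢ 1#
    ⁻¹-inverse : ∀ x → x ≢ 0# → x * (x ⁻¹) ≡ 1#
    isTotalOrder : IsTotalOrder _≡_ _≤_
    +-mono-≤ : ∀ x y z → x ≤ y → x + z ≤ y + z
    *-nonneg : ∀ x y → 0# ≤ x → 0# ≤ y → 0# ≤ x * y

  _-_ : Carrier → Carrier → Carrier
  x - y = x + (- y)

  abs : Carrier → Carrier
  abs x with IsTotalOrder.total isTotalOrder 0# x
  ... | inj₁ _ = x
  ... | inj₂ _ = - x

  fromℕ : ℕ → Carrier
  fromℕ zero = 0#
  fromℕ (suc k) = 1# + fromℕ k

  sumSub : ∀ {n} → Subset n → (Fin n → Carrier) → Carrier
  sumSub [] f = 0#
  sumSub (true ∷ A) f = f zero + sumSub A (λ i → f (suc i))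
  sumSub (false ∷ A) f = sumSub A (λ i → f (suc i))

  wSet : ∀ {n} → (Fin n → Fin n → Carrier) → Subset n → Subset n → Carrier
  wSet w A B = sumSub A (λ i → sumSub B (λ j → w i j))

  avgSim : ∀ {n} → (Fin n → Fin n → Carrier) → Subset n → Subset n → Carrier
  avgSim w A B = wSet w A B * ((fromℕ ∣ A ∣ * fromℕ ∣ B ∣) ⁻¹)

-- If A, B, C are runs of consecutive points with A left of B left of C, then every point of B
-- lies at least as close to every point of C as any point of A does; for a similarity that
-- decreases with distance this gives w_{aC} ≤ w_{bC} for all a ∈ A, b ∈ B, and averaging
-- yields avg(A, C) ≤ avg(B, C). Hence for b < c the pair (C_b, C_c) is dominated by the
-- adjacent pair (C_{c-1}, C_c), and by symmetry of w every pair is dominated by an adjacent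
-- one, so the best adjacent pair attains the maximum.
module Submission where

open import Defs
open import Data.Nat using (ℕ; suc)
open import Data.Fin using (Fin; suc; inject₁) renaming (_<_ to _<ᶠ_; _≤_ to _≤ᶠ_)
open import Data.Fin.Subset using (Subset; _∈_; Nonempty)
open import Data.Product using (_×_; ∃)
open import Relation.Binary.PropositionalEquality using (_≡_; _≢_)

open import Data.Nat using (zero)
open import Data.Nat.Properties using (<⇒≤)
open import Data.Bool using (true; false)
open import Data.Fin using (zero; _≟_)
open import Data.Fin.Properties using (<-cmp; ≤∧≢⇒<; ≤̄⇒inject₁<; <⇒≤pred)
  renaming (≤-refl to ≤ᶠ-refl)
open import Data.Fin.Subset using (∣_∣)
open import Data.Vec using ([]; _∷_; here; there)
open import Data.List using (allFin)
open import Data.List.Membership.Propositional.Properties using (∈-allFin)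
open import Data.List.Relation.Unary.All using (lookup)
import Data.List.Extrema
open import Data.Product using (_,_; proj₁; proj₂)
open import Data.Sum using (inj₁; inj₂)
open import Data.Empty using (⊥-elim)
open import Relation.Nullary using (¬_; yes; no; contradiction)
open import Relation.Binary.Definitions using (Tri; tri<; tri≈; tri>)
open import Relation.Binary.PropositionalEquality
  using (refl; sym; trans; cong; cong₂; module ≡-Reasoning)
open import Relation.Binary.Bundles using (Poset; TotalOrder)
open import Relation.Binary.Structures using (IsTotalOrder)
open import Algebra.Bundles using (CommutativeRing)
import Algebra.Properties.Ring
import Algebra.Properties.AbelianGroup
import Relation.Binary.Reasoning.PartialOrder

module OrderedFieldProperties (F : OrderedField) where
  open OrderedField F

  commutativeRing : CommutativeRing _ _
  commutativeRing = record { isCommutativeRing = isCommutativeRing }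

  open CommutativeRing commutativeRing
    using ( +-assoc; +-comm; +-identityˡ; +-identityʳ; -‿inverseˡ; -‿inverseʳ
          ; *-assoc; *-comm; *-identityˡ; zeroˡ; zeroʳ; distribˡ; distribʳ
          ; ring; +-abelianGroup )
  open Algebra.Properties.Ring ring using (-‿distribˡ-*; -‿distribʳ-*)
  open Algebra.Properties.AbelianGroup +-abelianGroup
    using (ε⁻¹≈ε; ⁻¹-involutive; ⁻¹-anti-homo‿-)
  open IsTotalOrder isTotalOrder public
    using (total; antisym) renaming (refl to ≤-refl; reflexive to ≤-reflexive; trans to ≤-trans)

  poset : Poset _ _ _
  poset = record { isPartialOrder = IsTotalOrder.isPartialOrder isTotalOrder }

  module ≤-Reasoning = Relation.Binary.Reasoning.PartialOrder poset

  +-monoʳ-≤ : ∀ z {a b} → a ≤ b → z + a ≤ z + b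
  +-monoʳ-≤ z {a} {b} a≤b = begin
    z + a  ≡⟨ +-comm z a ⟩
    a + z  ≤⟨ +-mono-≤ a b z a≤b ⟩
    b + z  ≡⟨ +-comm b z ⟩
    z + b  ∎
    where open ≤-Reasoning

  +-mono-≤₂ : ∀ {a b c d} → a ≤ b → c ≤ d → a + c ≤ b + d
  +-mono-≤₂ {a} {b} a≤b c≤d = ≤-trans (+-mono-≤ a b _ a≤b) (+-monoʳ-≤ b c≤d)

  -‿antitone-≤ : ∀ {a b} → a ≤ b → - b ≤ - a
  -‿antitone-≤ {a} {b} a≤b = begin
    - b              ≡⟨ cancel a (- b) ⟨
    a + (- a + - b)  ≤⟨ +-mono-≤ a b _ a≤b ⟩
    b + (- a + - b)  ≡⟨ cong (b +_) (+-comm (- a) (- b)) ⟩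
    b + (- b + - a)  ≡⟨ cancel b (- a) ⟩
    - a              ∎
    where
    open ≤-Reasoning
    cancel : ∀ u v → u + (- u + v) ≡ v
    cancel u v = trans (sym (+-assoc u (- u) v))
                   (trans (cong (_+ v) (-‿inverseʳ u)) (+-identityˡ v))

  x≤y⇒x-y≤0 : ∀ {a b} → a ≤ b → a - b ≤ 0#
  x≤y⇒x-y≤0 {a} {b} a≤b = begin
    a - b  ≤⟨ +-mono-≤ a b (- b) a≤b ⟩
    b - b  ≡⟨ -‿inverseʳ b ⟩
    0#     ∎
    where open ≤-Reasoning

  x≤y⇒0≤y-x : ∀ {a b} → a ≤ b → 0# ≤ b - a
  x≤y⇒0≤y-x {a} {b} a≤b = begin
    0#     ≡⟨ -‿inverseʳ a ⟨
    a - a  ≤⟨ +-mono-≤ a b (- a) a≤b ⟩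
    b - a  ∎
    where open ≤-Reasoning

  0≤y-x⇒x≤y : ∀ {a b} → 0# ≤ b - a → a ≤ b
  0≤y-x⇒x≤y {a} {b} 0≤b-a = begin
    a             ≡⟨ +-identityˡ a ⟨
    0# + a        ≤⟨ +-mono-≤ 0# (b - a) a 0≤b-a ⟩
    (b - a) + a   ≡⟨ +-assoc b (- a) a ⟩
    b + (- a + a) ≡⟨ cong (b +_) (-‿inverseˡ a) ⟩
    b + 0#        ≡⟨ +-identityʳ b ⟩
    b             ∎
    where open ≤-Reasoning

  x≤0⇒0≤-x : ∀ {a} → a ≤ 0# → 0# ≤ - a
  x≤0⇒0≤-x {a} a≤0 = begin
    0#    ≡⟨ ε⁻¹≈ε ⟨
    - 0#  ≤⟨ -‿antitone-≤ a≤0 ⟩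
    - a   ∎
    where open ≤-Reasoning

  *-monoʳ-≤-nonneg : ∀ z {a b} → 0# ≤ z → a ≤ b → a * z ≤ b * z
  *-monoʳ-≤-nonneg z {a} {b} 0≤z a≤b = 0≤y-x⇒x≤y (begin
    0#                 ≤⟨ *-nonneg (b - a) z (x≤y⇒0≤y-x a≤b) 0≤z ⟩
    (b - a) * z        ≡⟨ distribʳ z b (- a) ⟩
    b * z + (- a) * z  ≡⟨ cong (b * z +_) (-‿distribˡ-* a z) ⟨
    b * z - a * z      ∎)
    where open ≤-Reasoning

  *-monoˡ-≤-nonneg : ∀ z {a b} → 0# ≤ z → a ≤ b → z * a ≤ z * b
  *-monoˡ-≤-nonneg z {a} {b} 0≤z a≤b = begin
    z * a  ≡⟨ *-comm z a ⟩
    a * z  ≤⟨ *-monoʳ-≤-nonneg z 0≤z a≤b ⟩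
    b * z  ≡⟨ *-comm b z ⟩
    z * b  ∎
    where open ≤-Reasoning

  0≤1 : 0# ≤ 1#
  0≤1 with total 0# 1#
  ... | inj₁ 0≤1 = 0≤1
  ... | inj₂ 1≤0 = ⊥-elim (0≢1 (antisym 0≤1′ 1≤0))
    where
    open ≤-Reasoning
    0≤-1 : 0# ≤ - 1#
    0≤-1 = x≤0⇒0≤-x 1≤0
    0≤1′ : 0# ≤ 1#
    0≤1′ = begin
      0#           ≤⟨ *-nonneg _ _ 0≤-1 0≤-1 ⟩
      - 1# * - 1#  ≡⟨ -‿distribˡ-* 1# (- 1#) ⟨
      - (1# * - 1#) ≡⟨ cong -_ (*-identityˡ (- 1#)) ⟩
      - - 1#       ≡⟨ ⁻¹-involutive 1# ⟩
      1#           ∎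

  ¬0≤-1 : ¬ (0# ≤ - 1#)
  ¬0≤-1 0≤-1 = 0≢1 (antisym 0≤1 (begin
    1#      ≡⟨ ⁻¹-involutive 1# ⟨
    - - 1#  ≤⟨ -‿antitone-≤ 0≤-1 ⟩
    - 0#    ≡⟨ ε⁻¹≈ε ⟩
    0#      ∎))
    where open ≤-Reasoning

  Positive : Carrier → Set
  Positive p = 0# ≤ p × p ≢ 0#

  *-≢0 : ∀ {p q} → p ≢ 0# → q ≢ 0# → p * q ≢ 0#
  *-≢0 {p} {q} p≢0 q≢0 pq≡0 = q≢0 (begin
    q                ≡⟨ *-identityˡ q ⟨
    1# * q           ≡⟨ cong (_* q) (⁻¹-inverse p p≢0) ⟨
    (p * p ⁻¹) * q   ≡⟨ cong (_* q) (*-comm p (p ⁻¹)) ⟩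
    (p ⁻¹ * p) * q   ≡⟨ *-assoc (p ⁻¹) p q ⟩
    p ⁻¹ * (p * q)   ≡⟨ cong (p ⁻¹ *_) pq≡0 ⟩
    p ⁻¹ * 0#        ≡⟨ zeroʳ (p ⁻¹) ⟩
    0#               ∎)
    where open ≡-Reasoning

  *-positive : ∀ {p q} → Positive p → Positive q → Positive (p * q)
  *-positive (0≤p , p≢0) (0≤q , q≢0) = *-nonneg _ _ 0≤p 0≤q , *-≢0 p≢0 q≢0

  ⁻¹-nonneg : ∀ {p} → Positive p → 0# ≤ p ⁻¹
  ⁻¹-nonneg {p} (0≤p , p≢0) with total 0# (p ⁻¹)
  ... | inj₁ 0≤p⁻¹ = 0≤p⁻¹
  ... | inj₂ p⁻¹≤0 = contradiction (begin
    0#               ≤⟨ *-nonneg p _ 0≤p (x≤0⇒0≤-x p⁻¹≤0) ⟩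
    p * - (p ⁻¹)     ≡⟨ -‿distribʳ-* p (p ⁻¹) ⟨
    - (p * p ⁻¹)     ≡⟨ cong -_ (⁻¹-inverse p p≢0) ⟩
    - 1#             ∎) ¬0≤-1
    where open ≤-Reasoning

  *-cancel-⁻¹ : ∀ c u v → c ≢ 0# → (c * u) * (v * c ⁻¹) ≡ u * v
  *-cancel-⁻¹ c u v c≢0 = begin
    (c * u) * (v * c ⁻¹)  ≡⟨ cong (_* (v * c ⁻¹)) (*-comm c u) ⟩
    (u * c) * (v * c ⁻¹)  ≡⟨ *-assoc u c (v * c ⁻¹) ⟩
    u * (c * (v * c ⁻¹))  ≡⟨ cong (λ t → u * (c * t)) (*-comm v (c ⁻¹)) ⟩
    u * (c * (c ⁻¹ * v))  ≡⟨ cong (u *_) (*-assoc c (c ⁻¹) v) ⟨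
    u * ((c * c ⁻¹) * v)  ≡⟨ cong (λ t → u * (t * v)) (⁻¹-inverse c c≢0) ⟩
    u * (1# * v)          ≡⟨ cong (u *_) (*-identityˡ v) ⟩
    u * v                 ∎
    where open ≡-Reasoning

  ≤-cross-divide : ∀ {p q X Y} → Positive p → Positive q →
                   q * X ≤ p * Y → X * p ⁻¹ ≤ Y * q ⁻¹
  ≤-cross-divide {p} {q} {X} {Y} p>0 q>0 qX≤pY = begin
    X * p ⁻¹                 ≡⟨ *-cancel-⁻¹ q X (p ⁻¹) (proj₂ q>0) ⟨
    (q * X) * (p ⁻¹ * q ⁻¹)  ≤⟨ *-monoʳ-≤-nonneg _ (*-nonneg _ _ (⁻¹-nonneg p>0) (⁻¹-nonneg q>0)) qX≤pY ⟩
    (p * Y) * (p ⁻¹ * q ⁻¹)  ≡⟨ cong ((p * Y) *_) (*-comm (p ⁻¹) (q ⁻¹)) ⟩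
    (p * Y) * (q ⁻¹ * p ⁻¹)  ≡⟨ *-cancel-⁻¹ p Y (q ⁻¹) (proj₂ p>0) ⟩
    Y * q ⁻¹                 ∎
    where open ≤-Reasoning

  fromℕ-nonneg : ∀ k → 0# ≤ fromℕ k
  fromℕ-nonneg zero = ≤-refl
  fromℕ-nonneg (suc k) = begin
    0#       ≡⟨ +-identityˡ 0# ⟨
    0# + 0#  ≤⟨ +-mono-≤₂ 0≤1 (fromℕ-nonneg k) ⟩
    fromℕ (suc k) ∎
    where open ≤-Reasoning

  fromℕ-suc-positive : ∀ k → Positive (fromℕ (suc k))
  fromℕ-suc-positive k = fromℕ-nonneg (suc k) , λ 1+k≡0 → 0≢1 (antisym 0≤1 (begin
    1#             ≡⟨ +-identityʳ 1# ⟨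
    1# + 0#        ≤⟨ +-monoʳ-≤ 1# (fromℕ-nonneg k) ⟩
    1# + fromℕ k   ≡⟨ 1+k≡0 ⟩
    0#             ∎))
    where open ≤-Reasoning

  totalOrder : TotalOrder _ _ _
  totalOrder = record { isTotalOrder = isTotalOrder }

  argmax-Fin : ∀ {m} (v : Fin (suc m) → Carrier) → ∃ λ a → ∀ b → v b ≤ v a
  argmax-Fin {m} v = argmax v zero (allFin (suc m))
                   , λ b → lookup (f[xs]≤f[argmax] zero (allFin (suc m))) (∈-allFin b)
    where open Data.List.Extrema totalOrder using (argmax; f[xs]≤f[argmax])

  abs-nonneg : ∀ {d} → 0# ≤ d → abs d ≡ d
  abs-nonneg {d} 0≤d with total 0# d
  ... | inj₁ _ = refl
  ... | inj₂ d≤0 = trans (cong -_ d≡0) (trans ε⁻¹≈ε (sym d≡0))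
    where d≡0 = antisym d≤0 0≤d

  abs-nonpos : ∀ {d} → d ≤ 0# → abs d ≡ - d
  abs-nonpos {d} d≤0 with total 0# d
  ... | inj₂ _ = refl
  ... | inj₁ 0≤d = trans d≡0 (trans (sym ε⁻¹≈ε) (cong -_ (sym d≡0)))
    where d≡0 = antisym d≤0 0≤d

  abs-sub-comm-≤ : ∀ {a b} → a ≤ b → abs (a - b) ≡ abs (b - a)
  abs-sub-comm-≤ {a} {b} a≤b = begin
    abs (a - b)  ≡⟨ abs-nonpos (x≤y⇒x-y≤0 a≤b) ⟩
    - (a - b)    ≡⟨ ⁻¹-anti-homo‿- a b ⟩
    b - a        ≡⟨ abs-nonneg (x≤y⇒0≤y-x a≤b) ⟨
    abs (b - a)  ∎
    where open ≡-Reasoning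

  abs-sub-comm : ∀ a b → abs (a - b) ≡ abs (b - a)
  abs-sub-comm a b with total a b
  ... | inj₁ a≤b = abs-sub-comm-≤ a≤b
  ... | inj₂ b≤a = sym (abs-sub-comm-≤ b≤a)

  abs-sub-antitone : ∀ {a b c} → a ≤ b → b ≤ c → abs (b - c) ≤ abs (a - c)
  abs-sub-antitone {a} {b} {c} a≤b b≤c = begin
    abs (b - c)  ≡⟨ abs-nonpos (x≤y⇒x-y≤0 b≤c) ⟩
    - (b - c)    ≤⟨ -‿antitone-≤ (+-mono-≤ a b (- c) a≤b) ⟩
    - (a - c)    ≡⟨ abs-nonpos (x≤y⇒x-y≤0 (≤-trans a≤b b≤c)) ⟨
    abs (a - c)  ∎
    where open ≤-Reasoning

  sumSub-cong : ∀ {m} (A : Subset m) {f h : Fin m → Carrier} →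
                (∀ i → f i ≡ h i) → sumSub A f ≡ sumSub A h
  sumSub-cong []          f≡h = refl
  sumSub-cong (true ∷ A)  f≡h = cong₂ _+_ (f≡h zero) (sumSub-cong A (λ i → f≡h (suc i)))
  sumSub-cong (false ∷ A) f≡h = sumSub-cong A (λ i → f≡h (suc i))

  sumSub-mono : ∀ {m} (A : Subset m) {f h : Fin m → Carrier} →
                (∀ {i} → i ∈ A → f i ≤ h i) → sumSub A f ≤ sumSub A h
  sumSub-mono []          f≤h = ≤-refl
  sumSub-mono (true ∷ A)  f≤h = +-mono-≤₂ (f≤h here) (sumSub-mono A (λ i∈A → f≤h (there i∈A)))
  sumSub-mono (false ∷ A) f≤h = sumSub-mono A (λ i∈A → f≤h (there i∈A))

  sumSub-const : ∀ {m} (A : Subset m) t → sumSub A (λ _ → t) ≡ fromℕ ∣ A ∣ * t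
  sumSub-const []          t = sym (zeroˡ t)
  sumSub-const (true ∷ A)  t = begin
    t + sumSub A (λ _ → t)    ≡⟨ cong (t +_) (sumSub-const A t) ⟩
    t + fromℕ ∣ A ∣ * t        ≡⟨ cong (_+ fromℕ ∣ A ∣ * t) (*-identityˡ t) ⟨
    1# * t + fromℕ ∣ A ∣ * t   ≡⟨ distribʳ t 1# (fromℕ ∣ A ∣) ⟨
    (1# + fromℕ ∣ A ∣) * t     ∎
    where open ≡-Reasoning
  sumSub-const (false ∷ A) t = sumSub-const A t

  *-distribˡ-sumSub : ∀ {m} (A : Subset m) t f → t * sumSub A f ≡ sumSub A (λ i → t * f i)
  *-distribˡ-sumSub []          t f = zeroʳ t
  *-distribˡ-sumSub (true ∷ A)  t f =
    trans (distribˡ t _ _) (cong (t * f zero +_) (*-distribˡ-sumSub A t _))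
  *-distribˡ-sumSub (false ∷ A) t f = *-distribˡ-sumSub A t _

  sumSub-distrib-+ : ∀ {m} (A : Subset m) f h →
                     sumSub A (λ i → f i + h i) ≡ sumSub A f + sumSub A h
  sumSub-distrib-+ []          f h = sym (+-identityʳ 0#)
  sumSub-distrib-+ (true ∷ A)  f h = begin
    (f zero + h zero) + sumSub A (λ i → f (suc i) + h (suc i))
      ≡⟨ cong ((f zero + h zero) +_) (sumSub-distrib-+ A _ _) ⟩
    (f zero + h zero) + (sF + sH)  ≡⟨ +-assoc (f zero) (h zero) (sF + sH) ⟩
    f zero + (h zero + (sF + sH))  ≡⟨ cong (f zero +_) (+-assoc (h zero) sF sH) ⟨
    f zero + ((h zero + sF) + sH)  ≡⟨ cong (λ t → f zero + (t + sH)) (+-comm (h zero) sF) ⟩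
    f zero + ((sF + h zero) + sH)  ≡⟨ cong (f zero +_) (+-assoc sF (h zero) sH) ⟩
    f zero + (sF + (h zero + sH))  ≡⟨ +-assoc (f zero) sF (h zero + sH) ⟨
    (f zero + sF) + (h zero + sH)  ∎
    where
    open ≡-Reasoning
    sF = sumSub A (λ i → f (suc i))
    sH = sumSub A (λ i → h (suc i))
  sumSub-distrib-+ (false ∷ A) f h = sumSub-distrib-+ A _ _

  sumSub-swap : ∀ {m p} (A : Subset m) (B : Subset p) (h : Fin m → Fin p → Carrier) →
                sumSub A (λ i → sumSub B (h i)) ≡ sumSub B (λ j → sumSub A (λ i → h i j))
  sumSub-swap []          B h = sym (trans (sumSub-const B 0#) (zeroʳ _))
  sumSub-swap (true ∷ A)  B h =
    trans (cong (sumSub B (h zero) +_) (sumSub-swap A B (λ i → h (suc i))))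
          (sym (sumSub-distrib-+ B _ _))
  sumSub-swap (false ∷ A) B h = sumSub-swap A B (λ i → h (suc i))

  fromℕ∣∣-positive : ∀ {m} {A : Subset m} → Nonempty A → Positive (fromℕ ∣ A ∣)
  fromℕ∣∣-positive {A = true ∷ A}  _                  = fromℕ-suc-positive ∣ A ∣
  fromℕ∣∣-positive {A = false ∷ A} (suc i , there i∈A) = fromℕ∣∣-positive (i , i∈A)

module AverageSimilarity (F : OrderedField) where
  open OrderedField F
  open OrderedFieldProperties F
  open CommutativeRing commutativeRing using (*-assoc; *-comm)

  module _ {n : ℕ} (w : Fin n → Fin n → Carrier) where

    wSet-cross-≤ : ∀ A B C → (∀ {a b} → a ∈ A → b ∈ B → sumSub C (w a) ≤ sumSub C (w b)) →
                   fromℕ ∣ B ∣ * wSet w A C ≤ fromℕ ∣ A ∣ * wSet w B C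
    wSet-cross-≤ A B C rowA≤rowB = begin
      fromℕ ∣ B ∣ * sumSub A row            ≡⟨ sumSub-const B _ ⟨
      sumSub B (λ _ → sumSub A row)         ≤⟨ sumSub-mono B (λ b∈B → sumSub-mono A (λ a∈A → rowA≤rowB a∈A b∈B)) ⟩
      sumSub B (λ b → sumSub A (λ _ → row b)) ≡⟨ sumSub-cong B (λ b → sumSub-const A (row b)) ⟩
      sumSub B (λ b → fromℕ ∣ A ∣ * row b)   ≡⟨ *-distribˡ-sumSub B _ row ⟨
      fromℕ ∣ A ∣ * sumSub B row            ∎
      where
      open ≤-Reasoning
      row : Fin n → Carrier
      row i = sumSub C (w i)

    avgSim-monoˡ : ∀ {A B C} → Nonempty A → Nonempty B → Nonempty C →
                   (∀ {a b c} → a ∈ A → b ∈ B → c ∈ C → w a c ≤ w b c) →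
                   avgSim w A C ≤ avgSim w B C
    avgSim-monoˡ {A} {B} {C} neA neB neC closer =
      ≤-cross-divide (*-positive |A|>0 |C|>0) (*-positive |B|>0 |C|>0) (begin
        (|B| * |C|) * wSet w A C  ≡⟨ swap-assoc |B| |C| _ ⟩
        |C| * (|B| * wSet w A C)  ≤⟨ *-monoˡ-≤-nonneg |C| (proj₁ |C|>0) (wSet-cross-≤ A B C rows) ⟩
        |C| * (|A| * wSet w B C)  ≡⟨ swap-assoc |A| |C| _ ⟨
        (|A| * |C|) * wSet w B C  ∎)
      where
      open ≤-Reasoning
      |A| = fromℕ ∣ A ∣
      |B| = fromℕ ∣ B ∣
      |C| = fromℕ ∣ C ∣
      |A|>0 = fromℕ∣∣-positive neA
      |B|>0 = fromℕ∣∣-positive neB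
      |C|>0 = fromℕ∣∣-positive neC
      rows : ∀ {a b} → a ∈ A → b ∈ B → sumSub C (w a) ≤ sumSub C (w b)
      rows a∈A b∈B = sumSub-mono C (closer a∈A b∈B)
      swap-assoc : ∀ u v t → (u * v) * t ≡ v * (u * t)
      swap-assoc u v t = trans (cong (_* t) (*-comm u v)) (*-assoc v u t)

    avgSim-sym : (∀ i j → w i j ≡ w j i) → ∀ A B → avgSim w A B ≡ avgSim w B A
    avgSim-sym w-sym A B = cong₂ _*_
      (trans (sumSub-swap A B w) (sumSub-cong B (λ j → sumSub-cong A (λ i → w-sym i j))))
      (cong _⁻¹ (*-comm _ _))

  record IsRobinson {n : ℕ} (w : Fin n → Fin n → Carrier) : Set where
    field
      symmetric : ∀ i j → w i j ≡ w j i
      closer-≥  : ∀ {i j l} → i <ᶠ j → j <ᶠ l → w i l ≤ w j l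

  _≺_ : ∀ {n} → Subset n → Subset n → Set
  A ≺ B = ∀ i j → i ∈ A → j ∈ B → i <ᶠ j

  module _ {n : ℕ} {w : Fin n → Fin n → Carrier} (robinson : IsRobinson w) where
    open IsRobinson robinson

    avgSim-≺-monoˡ : ∀ {A B C} → Nonempty A → Nonempty B → Nonempty C →
                     A ≺ B → B ≺ C → avgSim w A C ≤ avgSim w B C
    avgSim-≺-monoˡ neA neB neC A≺B B≺C = avgSim-monoˡ w neA neB neC
      (λ {a} {b} {c} a∈A b∈B c∈C → closer-≥ (A≺B a b a∈A b∈B) (B≺C b c b∈B c∈C))

    adjacent-avgSim-maximal :
      (k : ℕ) (C : Fin (suc (suc k)) → Subset n) → (∀ a → Nonempty (C a)) →
      (∀ a b → a <ᶠ b → C a ≺ C b) →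
      ∃ λ (a : Fin (suc k)) → ∀ b c → b ≢ c →
        avgSim w (C b) (C c) ≤ avgSim w (C (inject₁ a)) (C (suc a))
    adjacent-avgSim-maximal k C nonempty ordered =
      best , λ b c b≢c → dominated b c b≢c (<-cmp b c)
      where
      adjacent : Fin (suc k) → Carrier
      adjacent a = avgSim w (C (inject₁ a)) (C (suc a))

      best : Fin (suc k)
      best = proj₁ (argmax-Fin adjacent)

      adjacent≤best : ∀ a → adjacent a ≤ adjacent best
      adjacent≤best = proj₂ (argmax-Fin adjacent)

      increasing : ∀ b c → b <ᶠ c → avgSim w (C b) (C c) ≤ adjacent best
      increasing b (suc c) b<1+c with b ≟ inject₁ c
      ... | yes refl = adjacent≤best c
      ... | no  b≢c  = ≤-trans
        (avgSim-≺-monoˡ (nonempty _) (nonempty _) (nonempty _)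
          (ordered b (inject₁ c) (≤∧≢⇒< (<⇒≤pred b<1+c) b≢c))
          (ordered (inject₁ c) (suc c) (≤̄⇒inject₁< ≤ᶠ-refl)))
        (adjacent≤best c)

      dominated : ∀ b c → b ≢ c → Tri (b <ᶠ c) (b ≡ c) (c <ᶠ b) → avgSim w (C b) (C c) ≤ adjacent best
      dominated b c _   (tri< b<c _ _) = increasing b c b<c
      dominated b c b≢c (tri≈ _ b≡c _) = contradiction b≡c b≢c
      dominated b c _   (tri> _ _ c<b) =
        ≤-trans (≤-reflexive (avgSim-sym w symmetric (C b) (C c))) (increasing c b c<b)

  distanceSimilarity-isRobinson :
    ∀ {n} {x : Fin n → Carrier} → (∀ i j → i ≤ᶠ j → x i ≤ x j) →
    ∀ {g : Carrier → Carrier} → (∀ a b → a ≤ b → g b ≤ g a) →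
    IsRobinson (λ i j → g (abs (x i - x j)))
  distanceSimilarity-isRobinson {x = x} x-mono {g} g-antitone = record
    { symmetric = λ i j → cong g (abs-sub-comm (x i) (x j))
    ; closer-≥  = λ {i} {j} {l} i<j j<l → g-antitone _ _
        (abs-sub-antitone (x-mono i j (<⇒≤ i<j)) (x-mono j l (<⇒≤ j<l)))
    }

mainTheorem1 : (F : OrderedField) → let open OrderedField F in
    (n : ℕ) (x : Fin n → Carrier) → (∀ i j → i ≤ᶠ j → x i ≤ x j) →
    (g : Carrier → Carrier) → (∀ a b → a ≤ b → g b ≤ g a) →
    (∀ a → 0# ≤ g a × g a ≤ 1#) →
    (k : ℕ) (C : Fin (suc (suc k)) → Subset n) →
    (∀ a → Nonempty (C a)) →
    (∀ i → ∃ λ a → i ∈ C a × (∀ b → i ∈ C b → b ≡ a)) →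
    (∀ a b i j → a <ᶠ b → i ∈ C a → j ∈ C b → i <ᶠ j) →
    ∃ λ (a : Fin (suc k)) → ∀ b c → b ≢ c →
      avgSim (λ i j → g (abs (x i - x j))) (C b) (C c)
        ≤ avgSim (λ i j → g (abs (x i - x j))) (C (inject₁ a)) (C (suc a))
mainTheorem1 F n x x-mono g g-antitone _ k C nonempty _ ordered =
  adjacent-avgSim-maximal (distanceSimilarity-isRobinson x-mono g-antitone) k C nonempty
    (λ a b a<b i j → ordered a b i j a<b)
  where open AverageSimilarity F
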